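{- Let $m \geq 1$, $k \geq 2$ and let $n_1 \le \dots \le n_k$ be positive integers with $n_k > 1$. Let $F = mK_{n_1,\ldots,n_k}$ be the disjoint union of $m$ copies of the complete $k$-partite graph with parts of sizes $n_1,\ldots,n_k$, and let $\ell = m(n_1+\dots+n_k)$ be its number of vertices. Then the graph $G^m_{\ell-1,k}$ contains no induced subgraph isomorphic to $F$.
   Context: For positive integers $L, k, m$, the almost multipartite graph $G^m_{L,k}$ has vertex set $\{(i,j,h) : 1 \le i \le L,\ 1 \le j \le k,\ 1 \le h \le m\}$, and two vertices are adjacent iff either they are of the form $(i_1,j_1,h),(i_2,j_2,h)$ with $i_1 \ne i_2$ and $j_1 \ne j_2$, or they are of the form $(i,j_1,h_1),(i,j_2,h_2)$ with $h_1 \ne h_2$. -}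

module Defs where

open import Data.Nat using (ℕ; suc; _+_; _*_; _∸_)
open import Data.Fin using (Fin)
open import Data.Product using (Σ; _×_; _,_)
open import Relation.Binary.PropositionalEquality using (_≡_; _≢_)
open import Function.Bundles using (_⇔_)
open import Function.Definitions using (Injective)
open import Level using (0ℓ)

Σᶠ : ∀ {k} → (Fin k → ℕ) → ℕ
Σᶠ {ℕ.zero} f = 0
Σᶠ {suc k} f = f Fin.zero + Σᶠ (λ i → f (Fin.suc i))

record Graph : Set₁ where
  field
    V   : Set
    Adj : V → V → Set

open Graph public

almostMultipartite : (L k m : ℕ) → Graph
almostMultipartite L k m = record
  { V = Fin L × Fin k × Fin m
  ; Adj = λ { (i₁ , j₁ , h₁) (i₂ , j₂ , h₂) →
      (h₁ ≡ h₂ × i₁ ≢ i₂ × j₁ ≢ j₂) ⊎' (i₁ ≡ i₂ × h₁ ≢ h₂) }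
  }
  where
  open import Data.Sum using () renaming (_⊎_ to _⊎'_)

-- m K_{n_1,...,n_k}: vertex (c , j , t) = t-th vertex of part j in copy c
multiCompleteMultipartite : (m k : ℕ) → (Fin k → ℕ) → Graph
multiCompleteMultipartite m k n = record
  { V = Σ (Fin m) (λ _ → Σ (Fin k) (λ j → Fin (n j)))
  ; Adj = λ { (c₁ , j₁ , _) (c₂ , j₂ , _) → c₁ ≡ c₂ × j₁ ≢ j₂ }
  }

InducedSubgraph : Graph → Graph → Set
InducedSubgraph F G =
  Σ (V F → V G) λ f →
    Injective _≡_ _≡_ f ×
    (∀ u v → Adj F u v ⇔ Adj G (f u) (f v))

module Submission where

-- Given an induced embedding f : F → G we show that distinct vertices of F
-- land in distinct rows, so F has at most L vertices; but it has L + 1.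
--  * Geometry of G: inside a layer, vertices are adjacent iff they differ in
--    row and column; across layers, iff they share their row.  Consequently,
--    if d is adjacent to two distinct non-adjacent vertices a, b, then the
--    layer of d or of a is private: no edge between common non-neighbours of
--    d, a, b starts in it.
--  * With d, a, b in copy c of F (d in one part, a, b in another) this gives
--    a layer ownLayer c that copy c meets and every other copy avoids (each
--    vertex of F has a neighbour in its own copy).  So ownLayer is an
--    injective self-map of Fin m, and by pigeonhole copy c lies in ownLayer c.
--  * Within a layer adjacent vertices get distinct columns; pigeonhole with k
--    columns for k parts makes every part of a copy monochromatic in column.
--  * Two vertices in one row lie in one copy, hence one layer, hence (being
--    non-adjacent) in one part, hence one column: they coincide.

open import Defs
open import Data.Nat using (ℕ; suc; _≤_; _<_; _*_; _∸_)
open import Data.Nat.Properties using (1+n≰n; ≤-trans; m≤m+n; *-mono-≤)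
open import Data.Fin using (Fin; fromℕ; zero; suc; toℕ; fromℕ<; splitAt; join; remQuot; combine)
open import Data.Fin using () renaming (_≤_ to _≤ᶠ_)
open import Data.Fin.Properties using (_≟_; toℕ-fromℕ<; join-splitAt; combine-remQuot; injective⇒≤)
open import Data.Product using (Σ; _×_; _,_; proj₁; proj₂)
open import Data.Sum using (_⊎_; inj₁; inj₂)
open import Data.Empty using (⊥; ⊥-elim)
open import Relation.Nullary using (¬_; Dec; yes; no)
open import Relation.Binary.PropositionalEquality using (_≡_; _≢_; refl; sym; trans; cong; cong₂)
open import Function.Bundles using (module Equivalence)
open import Function.Definitions using (Injective)

injective-self-map-fibre : ∀ {n} (g : Fin n → Fin n) → Injective _≡_ _≡_ g →
                           ∀ i y → (∀ j → j ≢ i → g j ≢ y) → g i ≡ y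
injective-self-map-fibre {n} g g-injective i y avoids with g i ≟ y
... | yes gi≡y = gi≡y
... | no gi≢y = ⊥-elim (1+n≰n (injective⇒≤ extended-injective))
  where
  misses : ∀ j → g j ≢ y
  misses j with j ≟ i
  ... | yes refl = gi≢y
  ... | no j≢i = avoids j j≢i
  -- adjoining the missed value y to g keeps it injective
  extended : Fin (suc n) → Fin n
  extended zero = y
  extended (suc j) = g j
  extended-injective : Injective _≡_ _≡_ extended
  extended-injective {zero} {zero} _ = refl
  extended-injective {zero} {suc j} y≡gj = ⊥-elim (misses j (sym y≡gj))
  extended-injective {suc j} {zero} gj≡y = ⊥-elim (misses j gj≡y)
  extended-injective {suc j} {suc j′} gj≡gj′ = cong suc (g-injective gj≡gj′)

part-colouring-monochromatic :
  ∀ {k} {P : Fin k → Set} (rep : ∀ j → P j) (χ : Σ (Fin k) P → Fin k) →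
  (∀ x y → proj₁ x ≢ proj₁ y → χ x ≢ χ y) →
  ∀ j (s : P j) → χ (j , rep j) ≡ χ (j , s)
part-colouring-monochromatic {k} rep χ proper j s =
  injective-self-map-fibre colourOf colourOf-injective j (χ (j , s))
    (λ j′ j′≢j → proper (j′ , rep j′) (j , s) j′≢j)
  where
  colourOf : Fin k → Fin k
  colourOf j′ = χ (j′ , rep j′)
  colourOf-injective : Injective _≡_ _≡_ colourOf
  colourOf-injective {j₁} {j₂} same with j₁ ≟ j₂
  ... | yes j₁≡j₂ = j₁≡j₂
  ... | no j₁≢j₂ = ⊥-elim (proper _ _ j₁≢j₂ same)

element : ∀ {k} (n : Fin k → ℕ) → Fin (Σᶠ n) → Σ (Fin k) (λ j → Fin (n j))
elementOfSplit : ∀ {k} (n : Fin (suc k) → ℕ) →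
                 Fin (n zero) ⊎ Fin (Σᶠ (λ j → n (suc j))) → Σ (Fin (suc k)) (λ j → Fin (n j))

element {suc k} n i = elementOfSplit n (splitAt (n zero) i)

shift : ∀ {k} {n : Fin (suc k) → ℕ} → Σ (Fin k) (λ j → Fin (n (suc j))) → Σ (Fin (suc k)) (λ j → Fin (n j))
shift (j , t) = suc j , t

shift-injective : ∀ {k} {n : Fin (suc k) → ℕ} → Injective _≡_ _≡_ (shift {n = n})
shift-injective {x = _ , _} {y = _ , _} refl = refl

elementOfSplit n (inj₁ t) = zero , t
elementOfSplit n (inj₂ s) = shift {n = n} (element (λ j → n (suc j)) s)

element-injective : ∀ {k} (n : Fin k → ℕ) → Injective _≡_ _≡_ (element n)
elementOfSplit-injective : ∀ {k} (n : Fin (suc k) → ℕ) → Injective _≡_ _≡_ (elementOfSplit n)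

element-injective {suc k} n {i} {i′} same =
  trans (sym (join-splitAt (n zero) _ i))
        (trans (cong (join (n zero) _) (elementOfSplit-injective n same))
               (join-splitAt (n zero) _ i′))

elementOfSplit-injective n {inj₁ t} {inj₁ .t} refl = refl
elementOfSplit-injective n {inj₁ t} {inj₂ s} ()
elementOfSplit-injective n {inj₂ s} {inj₁ t} ()
elementOfSplit-injective n {inj₂ s} {inj₂ s′} same =
  cong inj₂ (element-injective (λ j → n (suc j)) (shift-injective {n = n} same))

vertex : ∀ m {k} (n : Fin k → ℕ) → Fin (m * Σᶠ n) → V (multiCompleteMultipartite m k n)
vertex m n i = proj₁ (remQuot {m} (Σᶠ n) i) , element n (proj₂ (remQuot {m} (Σᶠ n) i))

vertex-injective : ∀ m {k} (n : Fin k → ℕ) → Injective _≡_ _≡_ (vertex m n)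
vertex-injective m n {i} {i′} same =
  trans (sym (combine-remQuot {m} (Σᶠ n) i))
    (trans (cong₂ combine (cong proj₁ same) (element-injective n (cong proj₂ same)))
           (combine-remQuot {m} (Σᶠ n) i′))

vertices-fit : ∀ m {k} (n : Fin k → ℕ) {L} (g : V (multiCompleteMultipartite m k n) → Fin L) →
               Injective _≡_ _≡_ g → m * Σᶠ n ≤ L
vertices-fit m n g g-injective = injective⇒≤ (λ same → vertex-injective m n (g-injective same))

module Geometry (L k m : ℕ) where

  Vertex : Set
  Vertex = Fin L × Fin k × Fin m

  _~_ : Vertex → Vertex → Set
  p ~ q = Adj (almostMultipartite L k m) p q

  row : Vertex → Fin L
  row = proj₁
  col : Vertex → Fin k
  col p = proj₁ (proj₂ p)
  layer : Vertex → Fin m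
  layer p = proj₂ (proj₂ p)

  vertex-≡ : ∀ {p q} → row p ≡ row q → col p ≡ col q → layer p ≡ layer q → p ≡ q
  vertex-≡ {_ , _ , _} {_ , _ , _} refl refl refl = refl

  ~-sym : ∀ {p q} → p ~ q → q ~ p
  ~-sym (inj₁ (h , r , c)) = inj₁ (sym h , (λ e → r (sym e)) , (λ e → c (sym e)))
  ~-sym (inj₂ (r , h)) = inj₂ (sym r , λ e → h (sym e))

  sameLayer-adj : ∀ {p q} → p ~ q → layer p ≡ layer q → row p ≢ row q × col p ≢ col q
  sameLayer-adj (inj₁ (_ , r , c)) _ = r , c
  sameLayer-adj (inj₂ (_ , h)) h≡ = ⊥-elim (h h≡)

  crossLayer-adj : ∀ {p q} → p ~ q → layer p ≢ layer q → row p ≡ row q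
  crossLayer-adj (inj₁ (h≡ , _)) h = ⊥-elim (h h≡)
  crossLayer-adj (inj₂ (r , _)) _ = r

  sameLayer-nonadj : ∀ {p q} → ¬ p ~ q → layer p ≡ layer q → row p ≡ row q ⊎ col p ≡ col q
  sameLayer-nonadj {p} {q} p≁q h≡ with row p ≟ row q | col p ≟ col q
  ... | yes r | _ = inj₁ r
  ... | no _ | yes c = inj₂ c
  ... | no r | no c = ⊥-elim (p≁q (inj₁ (h≡ , r , c)))

  crossLayer-nonadj : ∀ {p q} → ¬ p ~ q → layer p ≢ layer q → row p ≢ row q
  crossLayer-nonadj p≁q h r = p≁q (inj₂ (r , h))

  sameRow-nonadj : ∀ {p q} → ¬ p ~ q → row p ≡ row q → layer p ≡ layer q
  sameRow-nonadj {p} {q} p≁q r with layer p ≟ layer q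
  ... | yes h≡ = h≡
  ... | no h = ⊥-elim (p≁q (inj₂ (r , h)))

  -- A non-neighbour of an adjacent pair d ~ a in their layer sits at a
  -- corner of their rectangle: in the row of d or of a.
  corner : ∀ {d a z} → d ~ a → layer a ≡ layer d → layer z ≡ layer d →
           ¬ z ~ d → ¬ z ~ a → row z ≡ row d ⊎ row z ≡ row a
  corner d~a a≡d z≡d z≁d z≁a with sameLayer-nonadj z≁d z≡d | sameLayer-nonadj z≁a (trans z≡d (sym a≡d))
  ... | inj₁ zd | _ = inj₁ zd
  ... | inj₂ _ | inj₁ za = inj₂ za
  ... | inj₂ czd | inj₂ cza = ⊥-elim (proj₂ (sameLayer-adj d~a (sym a≡d)) (trans (sym czd) cza))

  -- Common non-neighbours of an adjacent pair d ~ a of one layer have no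
  -- edge from that layer to another: it would need a row of d or of a.
  edge-stays-in-layer : ∀ {d a z w} → d ~ a → layer a ≡ layer d → layer z ≡ layer d →
                        ¬ z ~ d → ¬ z ~ a → ¬ w ~ d → ¬ w ~ a → z ~ w → layer w ≡ layer d
  edge-stays-in-layer {d} {a} {z} {w} d~a a≡d z≡d z≁d z≁a w≁d w≁a z~w with layer w ≟ layer d
  ... | yes w≡d = w≡d
  ... | no w≢d = ⊥-elim (row-of-w-forbidden (corner d~a a≡d z≡d z≁d z≁a))
    where
    row-zw : row z ≡ row w
    row-zw = crossLayer-adj z~w (λ e → w≢d (trans (sym e) z≡d))
    row-of-w-forbidden : row z ≡ row d ⊎ row z ≡ row a → ⊥
    row-of-w-forbidden (inj₁ zd) = crossLayer-nonadj w≁d w≢d (trans (sym row-zw) zd)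
    row-of-w-forbidden (inj₂ za) = crossLayer-nonadj w≁a (λ e → w≢d (trans e a≡d)) (trans (sym row-zw) za)

  -- Two distinct non-adjacent vertices a, b of one layer share a row or a
  -- column; their common non-neighbours in the layer lie on that line, and a
  -- line of a layer is independent.
  commonNonNeighbours-independent :
    ∀ {a b z w} → a ≢ b → ¬ a ~ b → layer b ≡ layer a → layer z ≡ layer a → layer w ≡ layer a →
    ¬ z ~ a → ¬ z ~ b → ¬ w ~ a → ¬ w ~ b → ¬ z ~ w
  commonNonNeighbours-independent {a} {b} {z} {w} a≢b a≁b b≡a z≡a w≡a z≁a z≁b w≁a w≁b z~w =
    lineOf-ab-independent (sameLayer-nonadj a≁b (sym b≡a))
    where
    z≠w : row z ≢ row w × col z ≢ col w
    z≠w = sameLayer-adj z~w (trans z≡a (sym w≡a))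
    onRow : row a ≡ row b → ∀ {p} → layer p ≡ layer a → ¬ p ~ a → ¬ p ~ b → row p ≡ row a
    onRow row-ab p≡a p≁a p≁b with sameLayer-nonadj p≁a p≡a | sameLayer-nonadj p≁b (trans p≡a (sym b≡a))
    ... | inj₁ pa | _ = pa
    ... | inj₂ _ | inj₁ pb = trans pb (sym row-ab)
    ... | inj₂ pa | inj₂ pb = ⊥-elim (a≢b (vertex-≡ row-ab (trans (sym pa) pb) (sym b≡a)))
    onCol : col a ≡ col b → ∀ {p} → layer p ≡ layer a → ¬ p ~ a → ¬ p ~ b → col p ≡ col a
    onCol col-ab p≡a p≁a p≁b with sameLayer-nonadj p≁a p≡a | sameLayer-nonadj p≁b (trans p≡a (sym b≡a))
    ... | inj₂ pa | _ = pa
    ... | inj₁ _ | inj₂ pb = trans pb (sym col-ab)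
    ... | inj₁ pa | inj₁ pb = ⊥-elim (a≢b (vertex-≡ (trans (sym pa) pb) col-ab (sym b≡a)))
    lineOf-ab-independent : row a ≡ row b ⊎ col a ≡ col b → ⊥
    lineOf-ab-independent (inj₁ row-ab) =
      proj₁ z≠w (trans (onRow row-ab z≡a z≁a z≁b) (sym (onRow row-ab w≡a w≁a w≁b)))
    lineOf-ab-independent (inj₂ col-ab) =
      proj₂ z≠w (trans (onCol col-ab z≡a z≁a z≁b) (sym (onCol col-ab w≡a w≁a w≁b)))

  Avoids : Vertex → Vertex → Vertex → Vertex → Set
  Avoids d a b z = ¬ z ~ d × ¬ z ~ a × ¬ z ~ b

  PrivateLayer : Vertex → Vertex → Vertex → Fin m → Set
  PrivateLayer d a b P = ∀ {z w} → Avoids d a b z → Avoids d a b w → z ~ w → layer z ≢ P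

  private-swap : ∀ {d a b P} → PrivateLayer d a b P → PrivateLayer d b a P
  private-swap private′ (z≁d , z≁a , z≁b) (w≁d , w≁a , w≁b) = private′ (z≁d , z≁b , z≁a) (w≁d , w≁b , w≁a)

  private-when-a-beside-d : ∀ {d a b} → d ~ a → d ~ b → ¬ a ~ b → a ≢ b →
                            layer a ≡ layer d → PrivateLayer d a b (layer d)
  private-when-a-beside-d {d} {a} {b} d~a d~b a≁b a≢b a≡d {z} {w} (z≁d , z≁a , z≁b) (w≁d , w≁a , w≁b) z~w z≡d =
    by-layer-of-b (layer b ≟ layer d)
    where
    w≡d : layer w ≡ layer d
    w≡d = edge-stays-in-layer d~a a≡d z≡d z≁d z≁a w≁d w≁a z~w
    -- if b is outside the layer, the row of d is the row of b, which
    -- non-neighbours of b in this layer avoid; so they lie in the row of a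
    onRowOfA : layer b ≢ layer d → ∀ {p} → layer p ≡ layer d → ¬ p ~ d → ¬ p ~ a → ¬ p ~ b → row p ≡ row a
    onRowOfA b≢d p≡d p≁d p≁a p≁b with corner d~a a≡d p≡d p≁d p≁a
    ... | inj₂ pa = pa
    ... | inj₁ pd = ⊥-elim (crossLayer-nonadj p≁b (λ e → b≢d (trans (sym e) p≡d))
                      (trans pd (crossLayer-adj d~b (λ e → b≢d (sym e)))))
    by-layer-of-b : Dec (layer b ≡ layer d) → ⊥
    by-layer-of-b (yes b≡d) = commonNonNeighbours-independent a≢b a≁b (trans b≡d (sym a≡d))
                                (trans z≡d (sym a≡d)) (trans w≡d (sym a≡d)) z≁a z≁b w≁a w≁b z~w
    by-layer-of-b (no b≢d) = proj₁ (sameLayer-adj z~w (trans z≡d (sym w≡d)))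
                               (trans (onRowOfA b≢d z≡d z≁d z≁a z≁b) (sym (onRowOfA b≢d w≡d w≁d w≁a w≁b)))

  -- if neither a nor b shares the layer of d, the layer of a is private:
  -- a non-neighbour of d, a, b there would share the column of a and of b,
  -- while a, b already share row and layer
  private-when-a-b-across : ∀ {d a b} → d ~ a → d ~ b → ¬ a ~ b → a ≢ b →
                            layer a ≢ layer d → layer b ≢ layer d → PrivateLayer d a b (layer a)
  private-when-a-b-across {d} {a} {b} d~a d~b a≁b a≢b a≢d b≢d {z} (z≁d , z≁a , z≁b) _ _ z≡a =
    a≢b (vertex-≡ row-ab (trans (sym (column z≡a z≁a row-z≢a)) (column z≡b z≁b row-z≢b)) layer-ab)
    where
    row-da = crossLayer-adj d~a (λ e → a≢d (sym e))
    row-ab = trans (sym row-da) (crossLayer-adj d~b (λ e → b≢d (sym e)))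
    layer-ab = sameRow-nonadj a≁b row-ab
    z≡b = trans z≡a layer-ab
    row-z≢a : row z ≢ row a
    row-z≢a e = crossLayer-nonadj z≁d (λ e′ → a≢d (trans (sym z≡a) e′)) (trans e (sym row-da))
    row-z≢b : row z ≢ row b
    row-z≢b e = row-z≢a (trans e (sym row-ab))
    column : ∀ {p} → layer z ≡ layer p → ¬ z ~ p → row z ≢ row p → col z ≡ col p
    column z≡p z≁p r with sameLayer-nonadj z≁p z≡p
    ... | inj₁ zp = ⊥-elim (r zp)
    ... | inj₂ zp = zp

  private-layer : ∀ {d a b} → d ~ a → d ~ b → ¬ a ~ b → a ≢ b →
                  Σ (Fin m) λ P → (P ≡ layer d ⊎ P ≡ layer a) × PrivateLayer d a b P
  private-layer {d} {a} {b} d~a d~b a≁b a≢b with layer a ≟ layer d | layer b ≟ layer d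
  ... | yes a≡d | _ = layer d , inj₁ refl , private-when-a-beside-d d~a d~b a≁b a≢b a≡d
  ... | no _ | yes b≡d = layer d , inj₁ refl ,
        private-swap (private-when-a-beside-d d~b d~a (λ b~a → a≁b (~-sym b~a)) (λ e → a≢b (sym e)) b≡d)
  ... | no a≢d | no b≢d = layer a , inj₂ refl , private-when-a-b-across d~a d~b a≁b a≢b a≢d b≢d

module InducedEmbedding {m k : ℕ} {n : Fin k → ℕ} {L : ℕ}
  (nonempty : ∀ j → 1 ≤ n j) (J K : Fin k) (J≢K : J ≢ K) (two-in-K : 1 < n K)
  (embedding : InducedSubgraph (multiCompleteMultipartite m k n) (almostMultipartite L k m)) where

  open Geometry L k m

  VF : Set
  VF = V (multiCompleteMultipartite m k n)

  _~F_ : VF → VF → Set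
  u ~F v = Adj (multiCompleteMultipartite m k n) u v

  f : VF → Vertex
  f = proj₁ embedding

  f-injective : Injective _≡_ _≡_ f
  f-injective = proj₁ (proj₂ embedding)

  preserve : ∀ {u v} → u ~F v → f u ~ f v
  preserve {u} {v} = Equivalence.to (proj₂ (proj₂ embedding) u v)

  reflect : ∀ {u v} → f u ~ f v → u ~F v
  reflect {u} {v} = Equivalence.from (proj₂ (proj₂ embedding) u v)

  copy : VF → Fin m
  copy = proj₁

  rep : ∀ j → Fin (n j)
  rep j = fromℕ< (nonempty j)

  otherPart : Fin k → Fin k
  otherPart j with j ≟ J
  ... | yes _ = K
  ... | no _ = J

  otherPart-≢ : ∀ j → j ≢ otherPart j
  otherPart-≢ j with j ≟ J
  ... | yes j≡J = λ j≡K → J≢K (trans (sym j≡J) j≡K)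
  ... | no j≢J = j≢J

  neighbour : VF → VF
  neighbour (c , j , _) = c , otherPart j , rep (otherPart j)

  neighbour-adj : ∀ v → v ~F neighbour v
  neighbour-adj (_ , j , _) = refl , otherPart-≢ j

  apart : ∀ u v → copy u ≢ copy v → ¬ f u ~ f v
  apart u v c≢ fu~fv = c≢ (proj₁ (reflect fu~fv))

  d a b : Fin m → VF
  d c = c , J , rep J
  a c = c , K , rep K
  b c = c , K , fromℕ< two-in-K

  a≢b : ∀ c → a c ≢ b c
  a≢b c same with trans (sym (toℕ-fromℕ< (nonempty K)))
                    (trans (cong (λ v → toℕ (proj₂ (proj₂ v))) same) (toℕ-fromℕ< two-in-K))
  ... | ()

  privateLayerOf : ∀ c → Σ (Fin m) λ P → (P ≡ layer (f (d c)) ⊎ P ≡ layer (f (a c))) ×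
                                          PrivateLayer (f (d c)) (f (a c)) (f (b c)) P
  privateLayerOf c = private-layer (preserve (refl , J≢K)) (preserve (refl , J≢K))
                       (λ fa~fb → proj₂ (reflect {a c} {b c} fa~fb) refl) (λ same → a≢b c (f-injective same))

  ownLayer : Fin m → Fin m
  ownLayer c = proj₁ (privateLayerOf c)

  ownLayer-met : ∀ c → Σ VF λ v → copy v ≡ c × layer (f v) ≡ ownLayer c
  ownLayer-met c with proj₁ (proj₂ (privateLayerOf c))
  ... | inj₁ P≡d = d c , refl , sym P≡d
  ... | inj₂ P≡a = a c , refl , sym P≡a

  -- ... while vertices of other copies avoid it: they and their neighbours
  -- are common non-neighbours of d c, a c, b c
  ownLayer-avoided : ∀ z c → copy z ≢ c → layer (f z) ≢ ownLayer c
  ownLayer-avoided z c z∉c = proj₂ (proj₂ (privateLayerOf c)) (avoids z z∉c) (avoids (neighbour z) z∉c)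
                               (preserve (neighbour-adj z))
    where
    avoids : ∀ v → copy v ≢ c → Avoids (f (d c)) (f (a c)) (f (b c)) (f v)
    avoids v v∉c = apart v (d c) v∉c , apart v (a c) v∉c , apart v (b c) v∉c

  -- a vertex of copy c₁ in ownLayer c₁ would lie in ownLayer c₂
  ownLayer-injective : Injective _≡_ _≡_ ownLayer
  ownLayer-injective {c₁} {c₂} same with c₁ ≟ c₂
  ... | yes c₁≡c₂ = c₁≡c₂
  ... | no c₁≢c₂ with ownLayer-met c₁
  ...   | v , v∈c₁ , v-in-own = ⊥-elim (ownLayer-avoided v c₂ (λ e → c₁≢c₂ (trans (sym v∈c₁) e))
                                                             (trans v-in-own same))

  layer-of-copy : ∀ v → ownLayer (copy v) ≡ layer (f v)
  layer-of-copy v = injective-self-map-fibre ownLayer ownLayer-injective (copy v) (layer (f v))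
                      (λ c c≢v own≡ → ownLayer-avoided v c (λ e → c≢v (sym e)) (sym own≡))

  sameCopy⇒sameLayer : ∀ u v → copy u ≡ copy v → layer (f u) ≡ layer (f v)
  sameCopy⇒sameLayer u v same = trans (sym (layer-of-copy u)) (trans (cong ownLayer same) (layer-of-copy v))

  parts-get-distinct-columns : ∀ c x y → proj₁ x ≢ proj₁ y → col (f (c , x)) ≢ col (f (c , y))
  parts-get-distinct-columns c x y x≢y =
    proj₂ (sameLayer-adj (preserve (refl , x≢y)) (sameCopy⇒sameLayer (c , x) (c , y) refl))

  column-of-part : ∀ c j t → col (f (c , j , rep j)) ≡ col (f (c , j , t))
  column-of-part c = part-colouring-monochromatic rep (λ x → col (f (c , x))) (parts-get-distinct-columns c)

  -- one row and one layer: same copy by injectivity of ownLayer; one row,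
  -- different layers: adjacent in G, hence adjacent, so in one copy, in F
  sameRow⇒sameCopy : ∀ u v → row (f u) ≡ row (f v) → copy u ≡ copy v
  sameRow⇒sameCopy u v same-row with layer (f u) ≟ layer (f v)
  ... | yes same-layer = ownLayer-injective
          (trans (layer-of-copy u) (trans same-layer (sym (layer-of-copy v))))
  ... | no other-layer = proj₁ (reflect {u} {v} (inj₂ (same-row , other-layer)))

  -- same row ⇒ same copy and layer ⇒ non-adjacent ⇒ same part ⇒ same column
  row-injective : Injective _≡_ _≡_ (λ v → row (f v))
  row-injective {c , j , s} {c′ , j′ , t} same-row with sameRow⇒sameCopy (c , j , s) (c′ , j′ , t) same-row
  ... | refl with j ≟ j′
  ...   | yes refl = f-injective (vertex-≡ same-row
                       (trans (sym (column-of-part c j s)) (column-of-part c j t))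
                       (sameCopy⇒sameLayer (c , j , s) (c , j , t) refl))
  ...   | no j≢j′ = ⊥-elim (proj₁ (sameLayer-adj (preserve (refl , j≢j′))
                       (sameCopy⇒sameLayer (c , j , s) (c , j′ , t) refl)) same-row)

  enough-rows : m * Σᶠ n ≤ L
  enough-rows = vertices-fit m n (λ v → row (f v)) row-injective

not-below-predecessor : ∀ {N} → 1 ≤ N → ¬ N ≤ N ∸ 1
not-below-predecessor {suc N} _ = 1+n≰n

zero≢fromℕ : ∀ {k′} → 1 ≤ k′ → zero ≢ fromℕ k′
zero≢fromℕ {suc k′} _ ()

proposition4 : (m k′ : ℕ) → 1 ≤ m → 1 ≤ k′ →
    (n : Fin (suc k′) → ℕ) →
    (∀ i j → i ≤ᶠ j → n i ≤ n j) →
    (∀ i → 1 ≤ n i) →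
    1 < n (fromℕ k′) →
    ¬ InducedSubgraph (multiCompleteMultipartite m (suc k′) n)
                      (almostMultipartite (m * Σᶠ n ∸ 1) (suc k′) m)
proposition4 m k′ m≥1 k′≥1 n _ nonempty last-part-big embedding =
  not-below-predecessor F-nonempty
    (InducedEmbedding.enough-rows nonempty zero (fromℕ k′) (zero≢fromℕ k′≥1) last-part-big embedding)
  where
  F-nonempty : 1 ≤ m * Σᶠ n
  F-nonempty = *-mono-≤ m≥1 (≤-trans (nonempty zero) (m≤m+n (n zero) _))
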